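{- The concurrent-read (CR) version of the equivalence class sorting problem on $n$ elements with $k$ equivalence classes can be solved in $O(k + \log\log n)$ parallel rounds of equivalence tests, using $n$ processors in Valiant's parallel comparison model.
   Context: Equivalence class sorting (ECS): given a set $S$ of $n$ elements and an (unknown) equivalence relation on $S$ with $k$ equivalence classes, determine the partition of $S$ into its equivalence classes, where the only operation giving information about the relation is a pairwise equivalence test on two elements $x,y\in S$, which reveals only whether $x$ and $y$ are equivalent or not. Valiant's parallel comparison model: computation proceeds in synchronous rounds; in each round each of the $n$ processors may perform one equivalence test, and the tests chosen in a round may depend on the outcomes of all tests in earlier rounds; only the number of rounds containing tests is counted (all other computation is free). In the CR (concurrent-read) version, an element may take part in any number of tests in the same round. -}

module Defs where

open import Data.Nat using (ℕ; zero; suc; _+_; _<ᵇ_)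
open import Data.Bool using (Bool; true; false; not; _∧_)
open import Data.Fin using (Fin; toℕ)
open import Data.Product using (_×_; _,_)
open import Data.Vec using (Vec; map)
open import Data.List using (List; length; filter; allFin)
open import Data.Bool.ListAction using (any)
open import Relation.Binary.PropositionalEquality using (_≡_)
open import Relation.Binary.Structures using (IsEquivalence)
open import Data.Bool using (T?)

-- The unknown equivalence relation on the n elements (Fin n), given by its
-- Boolean equivalence-test oracle.
Oracle : ℕ → Set
Oracle n = Fin n → Fin n → Bool

IsEquivOracle : ∀ {n} → Oracle n → Set
IsEquivOracle E = IsEquivalence (λ x y → E x y ≡ true)

isRep : ∀ {n} → Oracle n → Fin n → Bool
isRep {n} E i = not (any (λ j → (toℕ j <ᵇ toℕ i) ∧ E j i) (allFin n))

-- Number of equivalence classes = number of class representatives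
-- (least elements of the classes).
numClasses : ∀ {n} → Oracle n → ℕ
numClasses {n} E = length (filter (λ i → T? (isRep E i)) (allFin n))

-- An adaptive algorithm in Valiant's parallel comparison model, CR version,
-- with n processors.  Each round consists of n equivalence tests (one per
-- processor), i.e. n arbitrary pairs of elements (an element may occur in
-- any number of the tests of a round).  All non-test computation is free.
data Algorithm (n : ℕ) : Set where
  output : (Fin n → Fin n) → Algorithm n
  round  : Vec (Fin n × Fin n) n → (Vec Bool n → Algorithm n) → Algorithm n

answers : ∀ {n} → Oracle n → Vec (Fin n × Fin n) n → Vec Bool n
answers E qs = map (λ { (x , y) → E x y }) qs

result : ∀ {n} → Algorithm n → Oracle n → (Fin n → Fin n)
result (output f) E = f
result (round qs k) E = result (k (answers E qs)) E

rounds : ∀ {n} → Algorithm n → Oracle n → ℕ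
rounds (output f) E = zero
rounds (round qs k) E = suc (rounds (k (answers E qs)) E)

CorrectPartition : ∀ {n} → Oracle n → (Fin n → Fin n) → Set
CorrectPartition E lab = ∀ x y → (lab x ≡ lab y → E x y ≡ true) × (E x y ≡ true → lab x ≡ lab y)

-- Scan the elements in increasing order, keeping a partial labelling by class
-- leaders.  An element still unlabelled when the scan reaches it is the least
-- element of its class; it becomes the leader, and one round testing it
-- against all n elements labels its whole class.  So there is one round per
-- class, and O(k) rounds already meet the bound O(k + log log n).
module Submission where

open import Defs
open import Data.Nat using (ℕ; suc; _+_; _*_; _≤_; _<ᵇ_; s≤s; z≤n)
open import Data.Nat.Logarithm using (⌊log₂_⌋)
open import Data.Product using (Σ; ∃; _×_; _,_)

open import Data.Bool using (Bool; true; false; T?; if_then_else_; _∧_)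
open import Data.Bool.ListAction using (any)
open import Data.Bool.Properties using (T-∧; T-≡; ¬-not)
open import Data.Empty using (⊥-elim)
open import Data.Fin as Fin using (Fin; toℕ)
open import Data.Fin.Properties using (<-irrefl; <-asym)
open import Data.List using (List; []; _∷_; length; filter; allFin)
open import Data.List.Membership.Propositional using (_∈_)
open import Data.List.Membership.Propositional.Properties using (∈-allFin)
import Data.List.Relation.Unary.All as All
open import Data.List.Relation.Unary.AllPairs as AllPairs using (AllPairs; []; _∷_)
open import Data.List.Relation.Unary.AllPairs.Properties using (tabulate⁺-<)
open import Data.List.Relation.Unary.Any using (here; there; satisfied)
open import Data.List.Relation.Unary.Any.Properties using (any⁻)
open import Data.Maybe using (Maybe; just; nothing; fromMaybe; _<∣>_)
open import Data.Maybe.Properties using (just-injective)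
open import Data.Nat.Properties using (≤-refl; ≤-trans; n≤1+n; m≤m+n; *-identityˡ; ≤-reflexive; <ᵇ⇒<)
open import Data.Sum using (_⊎_; inj₁; inj₂; [_,_])
open import Data.Vec using (Vec; lookup; tabulate)
open import Data.Vec.Properties using (lookup-map; lookup∘tabulate)
open import Function using (id)
open import Function.Bundles using (Equivalence)
open import Relation.Binary.PropositionalEquality using (_≡_; _≢_; refl; sym; trans; cong)
open import Relation.Binary.Structures using (IsEquivalence)

-- A partial labelling maps an element to the leader of its class, once known.
Labelling : ℕ → Set
Labelling n = Fin n → Maybe (Fin n)

labelOf : ∀ {n} → Labelling n → Fin n → Fin n
labelOf lab j = fromMaybe j (lab j)

testAgainstAll : ∀ {n} → Fin n → Vec (Fin n × Fin n) n
testAgainstAll i = tabulate (i ,_)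

claim : ∀ {n} → Fin n → (Fin n → Bool) → Labelling n → Labelling n
claim i equivalent lab j = lab j <∣> (if equivalent j then just i else nothing)

claim-keeps : ∀ {n} i (equivalent : Fin n → Bool) lab {x r} →
              lab x ≡ just r → claim i equivalent lab x ≡ just r
claim-keeps i equivalent lab lx rewrite lx = refl

claim-new : ∀ {n} i (equivalent : Fin n → Bool) lab {x} → lab x ≡ nothing → equivalent x ≡ true →
            claim i equivalent lab x ≡ just i
claim-new i equivalent lab lx eqx rewrite lx | eqx = refl

claim-cases : ∀ {n} i (equivalent : Fin n → Bool) lab {x r} → claim i equivalent lab x ≡ just r →
              lab x ≡ just r ⊎ (equivalent x ≡ true × r ≡ i)
claim-cases i equivalent lab {x} eq with lab x | equivalent x
... | just _  | _    = inj₁ eq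
... | nothing | true with refl ← eq = inj₂ (refl , refl)

sweep : ∀ {n} → List (Fin n) → Labelling n → Algorithm n
sweep [] lab = output (labelOf lab)
sweep (i ∷ is) lab with lab i
... | just _ = sweep is lab
... | nothing = round (testAgainstAll i) (λ ans → sweep is (claim i (lookup ans) lab))

leaderSweep : (n : ℕ) → Algorithm n
leaderSweep n = sweep (allFin n) (λ _ → nothing)

module _ {n : ℕ} (E : Oracle n) (isEquiv : IsEquivOracle E) where
  open IsEquivalence isEquiv renaming (refl to ≈-refl; sym to ≈-sym; trans to ≈-trans)

  _≈_ : Fin n → Fin n → Set
  x ≈ y = E x y ≡ true

  Assigned : Labelling n → Fin n → Set
  Assigned lab j = ∃ λ r → lab j ≡ just r

  record Consistent (lab : Labelling n) : Set where
    field
      leader-≈ : ∀ {x r} → lab x ≡ just r → r ≈ x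
      closed   : ∀ {x y r} → lab x ≡ just r → x ≈ y → lab y ≡ just r

  record SweepInvariant (lab : Labelling n) (xs : List (Fin n)) : Set where
    field
      consistent : Consistent lab
      ascending  : AllPairs Fin._<_ xs
      pending    : ∀ j → Assigned lab j ⊎ j ∈ xs

  roundAnswer : Fin n → Fin n → Bool
  roundAnswer i = lookup (answers E (testAgainstAll i))

  roundClaim : Fin n → Labelling n → Labelling n
  roundClaim i = claim i (roundAnswer i)

  roundAnswer-≡ : ∀ i j → roundAnswer i j ≡ E i j
  roundAnswer-≡ i j =
    trans (lookup-map j _ (testAgainstAll i)) (cong (λ (x , y) → E x y) (lookup∘tabulate (i ,_) j))

  roundClaim-cases : ∀ i lab {x r} → roundClaim i lab x ≡ just r → lab x ≡ just r ⊎ (i ≈ x × r ≡ i)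
  roundClaim-cases i lab {x} eq with claim-cases i (roundAnswer i) lab eq
  ... | inj₁ lx = inj₁ lx
  ... | inj₂ (answer , r≡i) = inj₂ (trans (sym (roundAnswer-≡ i x)) answer , r≡i)

  roundClaim-new : ∀ i lab {x} → lab x ≡ nothing → i ≈ x → roundClaim i lab x ≡ just i
  roundClaim-new i lab {x} lx i≈x = claim-new i (roundAnswer i) lab lx (trans (roundAnswer-≡ i x) i≈x)

  roundClaim-consistent : ∀ {i lab} → Consistent lab → lab i ≡ nothing → Consistent (roundClaim i lab)
  roundClaim-consistent {i} {lab} c li = record { leader-≈ = leader-≈′ ; closed = closed′ }
    where
    open Consistent c

    unassigned-class : ∀ {x} → i ≈ x → lab x ≡ nothing
    unassigned-class {x} i≈x with lab x in lx
    ... | just r with () ← trans (sym li) (closed lx (≈-sym i≈x))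
    ... | nothing = refl

    leader-≈′ : ∀ {x r} → roundClaim i lab x ≡ just r → r ≈ x
    leader-≈′ eq with roundClaim-cases i lab eq
    ... | inj₁ lx = leader-≈ lx
    ... | inj₂ (i≈x , refl) = i≈x

    closed′ : ∀ {x y r} → roundClaim i lab x ≡ just r → x ≈ y → roundClaim i lab y ≡ just r
    closed′ eq x≈y with roundClaim-cases i lab eq
    ... | inj₁ lx = claim-keeps i (roundAnswer i) lab (closed lx x≈y)
    ... | inj₂ (i≈x , refl) = roundClaim-new i lab (unassigned-class i≈y) i≈y
      where i≈y = ≈-trans i≈x x≈y

  unassigned-least⇒isRep : ∀ {lab i} → Consistent lab → lab i ≡ nothing →
                           (∀ j → j Fin.< i → Assigned lab j) → isRep E i ≡ true
  unassigned-least⇒isRep {i = i} c li earlier = sym (¬-not no-smaller-equivalent)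
    where
    open Consistent c
    no-smaller-equivalent : true ≢ any (λ j → (toℕ j <ᵇ toℕ i) ∧ E j i) (allFin n)
    no-smaller-equivalent true≡any
      with j , t ← satisfied (any⁻ _ (allFin n) (Equivalence.from T-≡ (sym true≡any)))
      with j<i , j≈i ← Equivalence.to T-∧ t
      with r , lj ← earlier j (<ᵇ⇒< (toℕ j) (toℕ i) j<i)
      with () ← trans (sym li) (closed lj (Equivalence.to T-≡ j≈i))

  complete⇒correct : ∀ {lab} → Consistent lab → (∀ j → Assigned lab j) →
                     CorrectPartition E (labelOf lab)
  complete⇒correct c assigned x y with assigned x | assigned y
  ... | r , lx | s , ly rewrite lx | ly =
    (λ { refl → ≈-trans (≈-sym (leader-≈ lx)) (leader-≈ ly) }) ,
    (λ x≈y → just-injective (trans (sym (closed lx x≈y)) ly))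
    where open Consistent c

  advance : ∀ {lab lab′ i is} → SweepInvariant lab (i ∷ is) → Consistent lab′ →
            (∀ {j r} → lab j ≡ just r → lab′ j ≡ just r) → Assigned lab′ i → SweepInvariant lab′ is
  advance {lab′ = lab′} {is = is} inv c′ keeps (r , l′i) = record
    { consistent = c′ ; ascending = AllPairs.tail ascending ; pending = pending′ }
    where
    open SweepInvariant inv
    pending′ : ∀ j → Assigned lab′ j ⊎ j ∈ is
    pending′ j with pending j
    ... | inj₁ (s , lj) = inj₁ (s , keeps lj)
    ... | inj₂ (here refl) = inj₁ (r , l′i)
    ... | inj₂ (there j∈is) = inj₂ j∈is

  skip-invariant : ∀ {lab i is} → SweepInvariant lab (i ∷ is) → Assigned lab i → SweepInvariant lab is
  skip-invariant inv = advance inv (SweepInvariant.consistent inv) id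

  claim-invariant : ∀ {lab i is} → SweepInvariant lab (i ∷ is) → lab i ≡ nothing →
                    SweepInvariant (roundClaim i lab) is
  claim-invariant {lab} {i} inv li =
    advance inv (roundClaim-consistent (SweepInvariant.consistent inv) li)
            (claim-keeps i (roundAnswer i) lab) (i , roundClaim-new i lab li ≈-refl)

  head-isRep : ∀ {lab i is} → SweepInvariant lab (i ∷ is) → lab i ≡ nothing → isRep E i ≡ true
  head-isRep {lab} {i} inv li = unassigned-least⇒isRep consistent li earlier
    where
    open SweepInvariant inv
    earlier : ∀ j → j Fin.< i → Assigned lab j
    earlier j j<i with pending j | ascending
    ... | inj₁ assigned | _ = assigned
    ... | inj₂ (here refl) | _ = ⊥-elim (<-irrefl refl j<i)
    ... | inj₂ (there j∈is) | i<is ∷ _ = ⊥-elim (<-asym j<i (All.lookup i<is j∈is))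

  repCount : List (Fin n) → ℕ
  repCount xs = length (filter (λ i → T? (isRep E i)) xs)

  repCount-∷ : ∀ i is → repCount is ≤ repCount (i ∷ is)
  repCount-∷ i is with isRep E i
  ... | true = n≤1+n _
  ... | false = ≤-refl

  repCount-∷-isRep : ∀ {i} is → isRep E i ≡ true → repCount (i ∷ is) ≡ suc (repCount is)
  repCount-∷-isRep is eq rewrite eq = refl

  sweep-correct : ∀ {lab} xs → SweepInvariant lab xs → CorrectPartition E (result (sweep xs lab) E)
  sweep-correct [] inv = complete⇒correct consistent (λ j → [ id , (λ ()) ] (pending j))
    where open SweepInvariant inv
  sweep-correct {lab} (i ∷ is) inv with lab i in li
  ... | just r = sweep-correct is (skip-invariant inv (r , li))
  ... | nothing = sweep-correct is (claim-invariant inv li)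

  sweep-rounds : ∀ {lab} xs → SweepInvariant lab xs → rounds (sweep xs lab) E ≤ repCount xs
  sweep-rounds [] inv = z≤n
  sweep-rounds {lab} (i ∷ is) inv with lab i in li
  ... | just r = ≤-trans (sweep-rounds is (skip-invariant inv (r , li))) (repCount-∷ i is)
  ... | nothing = ≤-trans (s≤s (sweep-rounds is (claim-invariant inv li)))
                          (≤-reflexive (sym (repCount-∷-isRep is (head-isRep inv li))))

  initial-invariant : SweepInvariant (λ _ → nothing) (allFin n)
  initial-invariant = record
    { consistent = record { leader-≈ = λ () ; closed = λ () }
    ; ascending  = tabulate⁺-< id
    ; pending    = λ j → inj₂ (∈-allFin j)
    }

  leaderSweep-correct : CorrectPartition E (result (leaderSweep n) E)
  leaderSweep-correct = sweep-correct (allFin n) initial-invariant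

  leaderSweep-rounds : rounds (leaderSweep n) E ≤ numClasses E
  leaderSweep-rounds = sweep-rounds (allFin n) initial-invariant

mainTheorem1 : Σ ℕ λ c → (n : ℕ) → Σ (Algorithm n) λ A →
    (E : Oracle n) → IsEquivOracle E →
      CorrectPartition E (result A E) ×
      rounds A E ≤ c * (numClasses E + ⌊log₂ ⌊log₂ n ⌋ ⌋) + c
mainTheorem1 = 1 , λ n → leaderSweep n , λ E isEquiv →
  leaderSweep-correct E isEquiv ,
  ≤-trans (leaderSweep-rounds E isEquiv) (k≤1*[k+l]+1 (numClasses E) ⌊log₂ ⌊log₂ n ⌋ ⌋)
  where
  k≤1*[k+l]+1 : ∀ k l → k ≤ 1 * (k + l) + 1
  k≤1*[k+l]+1 k l =
    ≤-trans (m≤m+n k l) (≤-trans (≤-reflexive (sym (*-identityˡ (k + l)))) (m≤m+n _ 1))
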